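{- Let $n\ge 2$, write $VQ_n=L\odot R$, and let $x_L,y_L$ be two vertices of $L$ with unique neighbors $x_R,y_R$ in $R$. Then $d_L(x_L,y_L)=d_R(x_R,y_R)$ if $n$ is not a multiple of $3$, and $|d_L(x_L,y_L)-d_R(x_R,y_R)|\le 2$ if $n=3k$ for some integer $k\ge 1$.
   Context: The $n$-dimensional varietal hypercube $VQ_n$ is defined recursively on the vertex set of binary strings of length $n$. $VQ_1$ is the complete graph on the two vertices $0$ and $1$. For $n>1$, let $VQ^0_{n-1}$ (resp. $VQ^1_{n-1}$) be the graph obtained from $VQ_{n-1}$ by prefixing $0$ (resp. $1$) to every vertex label. $VQ_n$ consists of $VQ^0_{n-1}$ and $VQ^1_{n-1}$ together with the following edges: a vertex $x=0x_{n-1}\cdots x_1$ and a vertex $y=1y_{n-1}\cdots y_1$ are adjacent if and only if either (1) $n$ is not a multiple of $3$ and $x_{n-1}\cdots x_1=y_{n-1}\cdots y_1$, or (2) $n$ is a multiple of $3$, $x_{n-3}\cdots x_1=y_{n-3}\cdots y_1$ and $(x_{n-1}x_{n-2},y_{n-1}y_{n-2})\in\{(00,00),(01,01),(10,11),(11,10)\}$. We write $VQ_n=L\odot R$ with $L=VQ^0_{n-1}$ and $R=VQ^1_{n-1}$ (as subgraphs of $VQ_n$); each vertex $x_L\in L$ has exactly one neighbor in $R$, denoted $x_R$. $d_H(u,v)$ denotes the distance between $u$ and $v$ in the graph $H$. -}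

module Defs where

open import Data.Nat using (ℕ; zero; suc; _≤_)
open import Data.Nat.Divisibility using (_∣_; _∣?_)
open import Data.Bool using (Bool; true; false; not; if_then_else_)
open import Data.Vec using (Vec; []; _∷_; head)
open import Data.Product using (_×_)
open import Data.Empty using (⊥)
open import Relation.Nullary using (does)
open import Relation.Binary.PropositionalEquality using (_≡_)

-- Vertices of VQ_n: Vec Bool n, written x_n x_{n-1} ... x_1 (head = x_n,
-- false = 0, true = 1).

-- Special cross-edge condition (case n multiple of 3) between
-- 0 x_{n-1}...x_1 and 1 y_{n-1}...y_1, given the two length-(n-1) tails:
-- x_{n-3}..x_1 = y_{n-3}..y_1 and
-- (x_{n-1}x_{n-2}, y_{n-1}y_{n-2}) ∈ {(00,00),(01,01),(10,11),(11,10)}.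
CrossMult3 : {m : ℕ} → Vec Bool m → Vec Bool m → Set
CrossMult3 (p ∷ q ∷ u) (p′ ∷ q′ ∷ v) =
  (u ≡ v) × (p′ ≡ p) × (q′ ≡ (if p then not q else q))
CrossMult3 _ _ = ⊥

Cross : (m : ℕ) → Vec Bool m → Vec Bool m → Set
Cross m u v = if does (3 ∣? suc m) then CrossMult3 u v else (u ≡ v)

VQ : (n : ℕ) → Vec Bool n → Vec Bool n → Set
VQ zero    []          []          = ⊥
VQ (suc m) (false ∷ u) (false ∷ v) = VQ m u v
VQ (suc m) (true ∷ u)  (true ∷ v)  = VQ m u v
VQ (suc m) (false ∷ u) (true ∷ v)  = Cross m u v
VQ (suc m) (true ∷ u)  (false ∷ v) = Cross m v u

-- Walks of length k from x to y in the subgraph of the graph with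
-- adjacency G induced by the vertex set P.
data Walk {V : Set} (G : V → V → Set) (P : V → Set) : V → V → ℕ → Set where
  here : ∀ {x} → P x → Walk G P x x zero
  step : ∀ {x y z k} → P x → G x y → Walk G P y z k → Walk G P x z (suc k)

IsDist : {V : Set} (G : V → V → Set) (P : V → Set) → V → V → ℕ → Set
IsDist G P x y d = Walk G P x y d × (∀ k → Walk G P x y k → d ≤ k)

InL : {m : ℕ} → Vec Bool (suc m) → Set
InL x = head x ≡ false

InR : {m : ℕ} → Vec Bool (suc m) → Set
InR x = head x ≡ true

module Submission where

-- Split VQ_(m+1) = L ⊙ R by the leading bit.  Deleting the
-- leading bit identifies both layers L and R with VQ_m, so walks inside a
-- layer are exactly walks in VQ_m of the same length.  The cross edges
-- decide how the endpoints x_R, y_R sit relative to x_L, y_L: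
--   * if 3 ∤ m+1, the cross edge joins 0u to 1u, so d_L(x_L,y_L) and
--     d_R(x_R,y_R) are both the VQ_m-distance of the same pair of tails;
--   * if 3 ∣ m+1, the cross edge joins 0u to 1(twist u), where twist flips
--     the second bit when the first is 1, and twist u is equal or adjacent
--     to u in VQ_m (the relevant edge of VQ_m is a plain cross edge because
--     3 ∤ m-1).  Rerouting a shortest walk through these at-most-one-step
--     detours at both ends changes its length by at most 2.
-- The file develops (1) generic walk surgery in a symmetric graph,
-- (2) the layer/VQ_m correspondence, (3) the shape of the cross edges and
-- the twist map, and finally derives lemma2p8.

open import Defs
open import Data.Nat using (ℕ; zero; suc; _≤_; ∣_-_∣; _+_; z≤n; s≤s)
open import Data.Nat.Properties
  using (≤-refl; ≤-trans; ≤-reflexive; ≤-antisym; ≤-total; +-mono-≤; +-monoʳ-≤; +-comm; +-suc;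
         m≤n+o⇒m∸n≤o; m≤n⇒∣m-n∣≡n∸m; m≤n⇒∣n-m∣≡n∸m)
open import Data.Nat.Divisibility using (_∣_; _∣?_; ∣m+n∣m⇒∣n; ∣⇒≤)
open import Data.Bool using (Bool; true; false; not; if_then_else_)
open import Data.Vec using (Vec; []; _∷_; head)
open import Data.Product using (Σ; _×_; _,_)
open import Data.Sum using (_⊎_; inj₁; inj₂)
open import Data.Unit using (⊤; tt)
open import Relation.Nullary using (¬_)
open import Relation.Nullary.Decidable using (dec-true; dec-false)
open import Relation.Binary.PropositionalEquality
  using (_≡_; refl; sym; subst)

Whole : {V : Set} → V → Set
Whole _ = ⊤

module WalkSurgery {V : Set} (G : V → V → Set) where

  _++ʷ_ : ∀ {x y z a b} → Walk G Whole x y a → Walk G Whole y z b →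
          Walk G Whole x z (a + b)
  here _     ++ʷ w′ = w′
  step p e w ++ʷ w′ = step p e (w ++ʷ w′)

  Close : V → V → Set
  Close x y = x ≡ y ⊎ G x y

  close-sym : (∀ {x y} → G x y → G y x) → ∀ {x y} → Close x y → Close y x
  close-sym _     (inj₁ refl) = inj₁ refl
  close-sym G-sym (inj₂ e)    = inj₂ (G-sym e)

  close-walk : ∀ {x y} → Close x y → Σ ℕ λ j → j ≤ 1 × Walk G Whole x y j
  close-walk (inj₁ refl) = 0 , z≤n , here tt
  close-walk (inj₂ e)    = 1 , ≤-refl , step tt e (here tt)

  reroute : ∀ {x x′ y y′ k} → Close x′ x → Close y y′ → Walk G Whole x y k →
            Σ ℕ λ j → j ≤ k + 2 × Walk G Whole x′ y′ j
  reroute {k = k} c c′ w with close-walk c | close-walk c′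
  ... | a , a≤1 , wa | b , b≤1 , wb =
    a + (k + b) , length-bound a≤1 b≤1 , wa ++ʷ (w ++ʷ wb)
    where
    length-bound : ∀ {a b} → a ≤ 1 → b ≤ 1 → a + (k + b) ≤ k + 2
    length-bound a≤1 b≤1 =
      ≤-trans (+-mono-≤ a≤1 (+-monoʳ-≤ k b≤1)) (≤-reflexive (sym (+-suc k 1)))

open WalkSurgery using (Close; reroute; close-sym)

-- VQ_n is an undirected graph: the two cross-edge clauses of Defs.VQ are
-- mirror images of each other.
VQ-sym : ∀ n {x y : Vec Bool n} → VQ n x y → VQ n y x
VQ-sym zero    {[]}        {[]}        ()
VQ-sym (suc m) {false ∷ u} {false ∷ v} e = VQ-sym m e
VQ-sym (suc m) {true ∷ u}  {true ∷ v}  e = VQ-sym m e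
VQ-sym (suc m) {false ∷ u} {true ∷ v}  e = e
VQ-sym (suc m) {true ∷ u}  {false ∷ v} e = e

InLayer : Bool → {m : ℕ} → Vec Bool (suc m) → Set
InLayer b x = head x ≡ b

layer-edge : ∀ {m} b {u v : Vec Bool m} → VQ (suc m) (b ∷ u) (b ∷ v) → VQ m u v
layer-edge false e = e
layer-edge true  e = e

layer-edge⁻¹ : ∀ {m} b {u v : Vec Bool m} → VQ m u v → VQ (suc m) (b ∷ u) (b ∷ v)
layer-edge⁻¹ false e = e
layer-edge⁻¹ true  e = e

walk-source : ∀ {V : Set} {G : V → V → Set} {P : V → Set} {x y k} →
              Walk G P x y k → P x
walk-source (here p)     = p
walk-source (step p _ _) = p

layer-down : ∀ {m k} b {u v : Vec Bool m} →
  Walk (VQ (suc m)) (InLayer b) (b ∷ u) (b ∷ v) k → Walk (VQ m) Whole u v k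
layer-down b (here _) = here tt
layer-down b (step {y = c ∷ _} _ e w) with walk-source w
... | refl = step tt (layer-edge b e) (layer-down b w)

layer-up : ∀ {m k} b {u v : Vec Bool m} →
  Walk (VQ m) Whole u v k → Walk (VQ (suc m)) (InLayer b) (b ∷ u) (b ∷ v) k
layer-up b (here _)     = here refl
layer-up b (step _ e w) = step refl (layer-edge⁻¹ b e) (layer-up b w)

layer-transfer : ∀ {m k} b b′ {u v : Vec Bool m} →
  Walk (VQ (suc m)) (InLayer b) (b ∷ u) (b ∷ v) k →
  Walk (VQ (suc m)) (InLayer b′) (b′ ∷ u) (b′ ∷ v) k
layer-transfer b b′ w = layer-up b′ (layer-down b w)

layer-reroute-bound : ∀ {m k d} b b′ {u v u′ v′ : Vec Bool m} →
  Close (VQ m) u′ u → Close (VQ m) v v′ →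
  Walk (VQ (suc m)) (InLayer b) (b ∷ u) (b ∷ v) k →
  (∀ j → Walk (VQ (suc m)) (InLayer b′) (b′ ∷ u′) (b′ ∷ v′) j → d ≤ j) →
  d ≤ k + 2
layer-reroute-bound b b′ c c′ w minimal with reroute _ c c′ (layer-down b w)
... | j , j≤k+2 , w′ = ≤-trans (minimal j (layer-up b′ w′)) j≤k+2

-- The twist map: the cross edge of VQ_(m+1), 3 ∣ m+1, joins 0u to 1(twist u).
twist : ∀ {m} → Vec Bool m → Vec Bool m
twist (p ∷ q ∷ w) = p ∷ (if p then not q else q) ∷ w
twist u           = u

cross-plain : ∀ {m} {u v : Vec Bool m} → ¬ (3 ∣ suc m) →
  VQ (suc m) (false ∷ u) (true ∷ v) → u ≡ v
cross-plain {m} {u} {v} 3∤ e =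
  subst (λ b → if b then CrossMult3 u v else (u ≡ v)) (dec-false (3 ∣? suc m) 3∤) e

plain-cross-edge : ∀ {m} (u : Vec Bool m) → ¬ (3 ∣ suc m) →
  VQ (suc m) (false ∷ u) (true ∷ u)
plain-cross-edge {m} u 3∤ =
  subst (λ b → if b then CrossMult3 u u else (u ≡ u)) (sym (dec-false (3 ∣? suc m) 3∤)) refl

cross-twisted : ∀ {m} {u v : Vec Bool m} → 3 ∣ suc m →
  VQ (suc m) (false ∷ u) (true ∷ v) → v ≡ twist u
cross-twisted {m} {u} {v} 3∣ e =
  twisted (subst (λ b → if b then CrossMult3 u v else (u ≡ v)) (dec-true (3 ∣? suc m) 3∣) e)
  where
  twisted : ∀ {n} {u v : Vec Bool n} → CrossMult3 u v → v ≡ twist u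
  twisted {u = _ ∷ _ ∷ _} {_ ∷ _ ∷ _} (refl , refl , refl) = refl

three-∤-predecessor : ∀ j → 3 ∣ suc (suc (suc j)) → ¬ (3 ∣ suc j)
three-∤-predecessor j 3∣j+3 3∣j+1
  with ∣⇒≤ (∣m+n∣m⇒∣n (subst (3 ∣_) (+-comm 2 (suc j)) 3∣j+3) 3∣j+1)
... | s≤s (s≤s ())

-- If 3 ∣ m+1, twisting moves a vertex of VQ_m by at most one edge: for
-- u = 1q w the edge 1q w – 1(¬q) w is the plain cross edge of VQ_(m-1).
twist-close : ∀ {m} (u : Vec Bool m) → 3 ∣ suc m → Close (VQ m) u (twist u)
twist-close {suc (suc j)} (true ∷ false ∷ w) 3∣ =
  inj₂ (plain-cross-edge w (three-∤-predecessor j 3∣))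
twist-close {suc (suc j)} (true ∷ true ∷ w) 3∣ =
  inj₂ (plain-cross-edge w (three-∤-predecessor j 3∣))
twist-close (false ∷ _ ∷ _) _ = inj₁ refl
twist-close []              _ = inj₁ refl
twist-close (_ ∷ [])        _ = inj₁ refl

∣-∣-bound : ∀ a b {c} → b ≤ a + c → a ≤ b + c → ∣ a - b ∣ ≤ c
∣-∣-bound a b b≤a+c a≤b+c with ≤-total a b
... | inj₁ a≤b rewrite m≤n⇒∣m-n∣≡n∸m a≤b = m≤n+o⇒m∸n≤o b a b≤a+c
... | inj₂ b≤a rewrite m≤n⇒∣n-m∣≡n∸m b≤a = m≤n+o⇒m∸n≤o a b a≤b+c

lemma2p8 : (m : ℕ) → 2 ≤ suc m →
    (xL yL xR yR : Vec Bool (suc m)) →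
    InL xL → InL yL → InR xR → InR yR →
    VQ (suc m) xL xR → VQ (suc m) yL yR →
    (dL dR : ℕ) →
    IsDist (VQ (suc m)) InL xL yL dL →
    IsDist (VQ (suc m)) InR xR yR dR →
    ((¬ (3 ∣ suc m) → dL ≡ dR) × (3 ∣ suc m → ∣ dL - dR ∣ ≤ 2))
lemma2p8 m _ (false ∷ u) (false ∷ v) (true ∷ u′) (true ∷ v′) refl refl refl refl
  ex ey dL dR (wL , minL) (wR , minR) = equal-distances , close-distances
  where
  equal-distances : ¬ (3 ∣ suc m) → dL ≡ dR
  equal-distances 3∤ with cross-plain 3∤ ex | cross-plain 3∤ ey
  ... | refl | refl =
    ≤-antisym (minL dR (layer-transfer true false wR))
              (minR dL (layer-transfer false true wL))

  close-distances : 3 ∣ suc m → ∣ dL - dR ∣ ≤ 2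
  close-distances 3∣ with cross-twisted 3∣ ex | cross-twisted 3∣ ey
  ... | refl | refl = ∣-∣-bound dL dR
    (layer-reroute-bound false true (twist-close′ u) (twist-close v 3∣) wL minR)
    (layer-reroute-bound true false (twist-close u 3∣) (twist-close′ v) wR minL)
    where
    twist-close′ : (w : Vec Bool m) → Close (VQ m) (twist w) w
    twist-close′ w = close-sym (VQ m) (VQ-sym m) (twist-close w 3∣)
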